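{- Let $G$ be an even integral symmetric $n\times n$ matrix, $r=a/c$ with $a\in\mathbb{Z}$, $c\in\mathbb{Z}_{\ge1}$ coprime, $\mathbf t=(t_1,\dots,t_n)\in\mathbb{Z}_{\ge1}^n$, and $\mathbf w,\mathbf x\in\mathbb{Q}^n$, such that $r\mathbf t\in\mathbb{Z}^n$, $G\mathbf w\in\mathbb{Z}^n$ and $a\mathbf x\in\mathbb{Z}^n$. Then $$\mathfrak G_G(r,\mathbf t;\mathbf w,\mathbf x)=\frac{\prod_{j=1}^nt_j}{c^n}\,\mathfrak G_G(r,(c,\dots,c);\mathbf w,\mathbf x).$$
   Context: $e(z)=\exp(2\pi i z)$. Even integral: integer entries, even diagonal. $\mathfrak G_G(r,\mathbf t;\mathbf w,\mathbf x)=\sum_{v_1=0}^{t_1-1}\cdots\sum_{v_n=0}^{t_n-1}e\big(r(\frac12(\mathbf v+\mathbf w)^TG(\mathbf v+\mathbf w)+(\mathbf v+\mathbf w)^T\mathbf x)\big)$, $\mathbf v=(v_1,\dots,v_n)$. -}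

module Defs where

open import Level using (Level)
open import Data.Nat as ℕ using (ℕ; zero; suc)
open import Data.Integer as ℤ using (ℤ; +_)
open import Data.Rational as ℚ using (ℚ; _/_)
open import Data.Fin using (Fin; zero; suc)
open import Data.Vec.Functional using (_∷_)
open import Data.Product using (∃)
open import Relation.Binary.PropositionalEquality using (_≡_)
open import Algebra.Bundles using (CommutativeRing)

ℤ→ℚ : ℤ → ℚ
ℤ→ℚ k = k / 1

ℕ→ℚ : ℕ → ℚ
ℕ→ℚ k = ℤ→ℚ (+ k)

IsInt : ℚ → Set
IsInt q = ∃ λ (k : ℤ) → q ≡ ℤ→ℚ k

sumℚ : (m : ℕ) → (Fin m → ℚ) → ℚ
sumℚ zero    f = ℚ.0ℚ
sumℚ (suc m) f = f zero ℚ.+ sumℚ m (λ i → f (suc i))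

prodℕ : (m : ℕ) → (Fin m → ℕ) → ℕ
prodℕ zero    f = 1
prodℕ (suc m) f = f zero ℕ.* prodℕ m (λ i → f (suc i))

matVec : {n : ℕ} → (Fin n → Fin n → ℤ) → (Fin n → ℚ) → Fin n → ℚ
matVec {n} G u i = sumℚ n (λ j → ℤ→ℚ (G i j) ℚ.* u j)

dot : {n : ℕ} → (Fin n → ℚ) → (Fin n → ℚ) → ℚ
dot {n} u y = sumℚ n (λ j → u j ℚ.* y j)

EvenIntegralSymmetric : {n : ℕ} → (Fin n → Fin n → ℤ) → Set
EvenIntegralSymmetric {n} G =
  ((i j : Fin n) → G i j ≡ G j i) ×' ((i : Fin n) → ∃ λ (k : ℤ) → G i i ≡ ℤ.+ 2 ℤ.* k)
  where open import Data.Product renaming (_×_ to _×'_)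

phase : {n : ℕ} → (Fin n → Fin n → ℤ) → ℚ → (Fin n → ℕ) → (Fin n → ℚ) → (Fin n → ℚ) → ℚ
phase G r v w x =
  r ℚ.* ((ℚ.½ ℚ.* dot u (matVec G u)) ℚ.+ dot u x)
  where u = λ i → ℕ→ℚ (v i) ℚ.+ w i

module _ {c ℓ : Level} (R : CommutativeRing c ℓ) where
  open CommutativeRing R using (Carrier; _≈_; _+_; _*_; 0#; 1#)

  ℕ→R : ℕ → Carrier
  ℕ→R zero    = 0#
  ℕ→R (suc k) = 1# + ℕ→R k

  -- sum over the box 0 ≤ v_j < t_j
  boxSum : (n : ℕ) → (Fin n → ℕ) → ((Fin n → ℕ) → Carrier) → Carrier
  boxSum zero    t f = f (λ ())
  boxSum (suc n) t f = go (t zero)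
    where
      go : ℕ → Carrier
      go zero    = 0#
      go (suc k) = boxSum n (λ i → t (suc i)) (λ v → f (k ∷ v)) + go k

  -- e is an additive character of ℚ trivial on ℤ (e.g. e(z) = exp(2πiz) into ℂ)
  IsExpChar : (ℚ → Carrier) → Set ℓ
  IsExpChar e = ((p q : ℚ) → e (p ℚ.+ q) ≈ e p * e q) ×'' ((k : ℤ) → e (ℤ→ℚ k) ≈ 1#)
    where open import Data.Product renaming (_×_ to _×''_)

  𝔊 : (e : ℚ → Carrier) → {n : ℕ} → (Fin n → Fin n → ℤ) → ℚ → (Fin n → ℕ) →
      (Fin n → ℚ) → (Fin n → ℚ) → Carrier
  𝔊 e {n} G r t w x = boxSum n t (λ v → e (phase G r v w x))

{-# OPTIONS --safe #-}
-- Write u = v + w. Moving v_j up by c changes the phase r(½ uᵀGu + uᵀx) by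
-- rc·(Gu)_j + rc·c·G_jj/2 + rc·x_j, an integer because rc = a, Gw and ax are integral
-- and G_jj is even; so the summand is c-periodic in every coordinate of v. Since a and c
-- are coprime, r t_j ∈ ℤ forces c ∣ t_j, and the box ∏ [0, t_j) is tiled by ∏ t_j / cⁿ
-- translates of [0, c)ⁿ, over each of which the summand has the same sum.
module Submission where

open import Defs
open import Level using (Level; 0ℓ)
open import Data.Nat as ℕ using (ℕ; NonZero; zero; suc)
import Data.Nat.Properties as ℕP
open import Data.Nat.Divisibility using (_∣_; divides)
open import Data.Integer as ℤ using (ℤ; +_)
import Data.Integer.Properties as ℤP
open import Data.Integer.Coprimality using (Coprime; coprime-divisor)
import Data.Integer.Coprimality as ℤC
open import Data.Integer.Tactic.RingSolver using () renaming (ring to ℤ-ring)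
open import Data.Rational as ℚ using (ℚ; _/_; toℚᵘ)
import Data.Rational.Properties as ℚP
open import Data.Rational.Unnormalised as ℚᵘ using (mkℚᵘ; *≡*) renaming (_≃_ to _≃ᵘ_)
import Data.Rational.Unnormalised.Properties as ℚᵘP
open import Data.Fin using (Fin; zero; suc)
open import Data.Vec.Functional using (Vector; _∷_; head; tail)
open import Data.Product using (∃-syntax; _,_; proj₁; proj₂)
open import Data.Maybe using (nothing)
open import Algebra.Bundles using (CommutativeRing)
open import Relation.Binary.PropositionalEquality using (_≡_; refl; sym; trans; cong; cong₂; subst; module ≡-Reasoning)
open import Tactic.RingSolver using (solve-∀)
open import Tactic.RingSolver.Core.AlmostCommutativeRing using (AlmostCommutativeRing; fromCommutativeRing)
open import Algebra.Properties.Semiring.Sum (CommutativeRing.semiring ℚP.+-*-commutativeRing) using (sum; sum-cong-≗; ∑-distrib-+; *-distribˡ-sum; sum-replicate-zero)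
open import Algebra.Properties.CommutativeSemigroup (CommutativeRing.*-commutativeSemigroup ℚP.+-*-commutativeRing) using (x∙yz≈y∙xz)

-- Recursion on the index, rather than updateAt, makes shiftAt c (suc j) (m ∷ v)
-- reduce to m ∷ shiftAt c j v.
shiftAt : {n : ℕ} → ℕ → Fin n → Vector ℕ n → Vector ℕ n
shiftAt c zero    v = (head v ℕ.+ c) ∷ tail v
shiftAt c (suc j) v = head v ∷ shiftAt c j (tail v)

module BoxSum {cℓ ℓ : Level} (R : CommutativeRing cℓ ℓ) where
  open CommutativeRing R hiding (zero) renaming (refl to ≈-refl; sym to ≈-sym; trans to ≈-trans)
  open import Relation.Binary.Reasoning.Setoid setoid
  open import Algebra.Properties.Semiring.Mult semiring using (_×_; ×1-homo-*)
  open import Algebra.Properties.CommutativeSemigroup *-commutativeSemigroup using (x∙yz≈yx∙z)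

  rsum : ℕ → (ℕ → Carrier) → Carrier
  rsum zero    g = 0#
  rsum (suc k) g = g k + rsum k g

  rsum-cong : ∀ k {f g} → (∀ m → f m ≈ g m) → rsum k f ≈ rsum k g
  rsum-cong zero    f≈g = ≈-refl
  rsum-cong (suc k) f≈g = +-cong (f≈g k) (rsum-cong k f≈g)

  rsum-+ : ∀ a b g → rsum (a ℕ.+ b) g ≈ rsum a (λ m → g (m ℕ.+ b)) + rsum b g
  rsum-+ zero    b g = ≈-sym (+-identityˡ _)
  rsum-+ (suc a) b g = ≈-trans (+-congˡ (rsum-+ a b g)) (≈-sym (+-assoc _ _ _))

  *-distribˡ-rsum : ∀ x k g → x * rsum k g ≈ rsum k (λ m → x * g m)
  *-distribˡ-rsum x zero    g = zeroʳ x
  *-distribˡ-rsum x (suc k) g = ≈-trans (distribˡ _ _ _) (+-congˡ (*-distribˡ-rsum x k g))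

  rsum-unique : ∀ B (g : ℕ → Carrier) → g 0 ≈ 0# → (∀ k → g (suc k) ≈ B k + g k) →
                ∀ k → g k ≈ rsum k B
  rsum-unique B g g0 gsuc zero    = g0
  rsum-unique B g g0 gsuc (suc k) = ≈-trans (gsuc k) (+-congˡ (rsum-unique B g g0 gsuc k))

  ℕ→R≈×1 : ∀ k → ℕ→R R k ≈ k × 1#
  ℕ→R≈×1 zero    = ≈-refl
  ℕ→R≈×1 (suc k) = +-congˡ (ℕ→R≈×1 k)

  ℕ→R-homo-* : ∀ m k → ℕ→R R (m ℕ.* k) ≈ ℕ→R R m * ℕ→R R k
  ℕ→R-homo-* m k = begin
    ℕ→R R (m ℕ.* k)        ≈⟨ ℕ→R≈×1 (m ℕ.* k) ⟩
    (m ℕ.* k) × 1#          ≈⟨ ×1-homo-* m k ⟩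
    (m × 1#) * (k × 1#)     ≈⟨ *-cong (ℕ→R≈×1 m) (ℕ→R≈×1 k) ⟨
    ℕ→R R m * ℕ→R R k      ∎

  module _ {c : ℕ} {S : ℕ → Carrier} (S-periodic : ∀ m → S (m ℕ.+ c) ≈ S m) where
    periodic-+* : ∀ q m → S (m ℕ.+ q ℕ.* c) ≈ S m
    periodic-+* zero    m = reflexive (cong S (ℕP.+-identityʳ m))
    periodic-+* (suc q) m = begin
      S (m ℕ.+ (c ℕ.+ q ℕ.* c))   ≡⟨ cong S (trans (cong (m ℕ.+_) (ℕP.+-comm c (q ℕ.* c))) (sym (ℕP.+-assoc m (q ℕ.* c) c))) ⟩
      S (m ℕ.+ q ℕ.* c ℕ.+ c)     ≈⟨ S-periodic _ ⟩
      S (m ℕ.+ q ℕ.* c)           ≈⟨ periodic-+* q m ⟩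
      S m                         ∎

    rsum-periodic : ∀ q → rsum (q ℕ.* c) S ≈ ℕ→R R q * rsum c S
    rsum-periodic zero    = ≈-sym (zeroˡ _)
    rsum-periodic (suc q) = begin
      rsum (c ℕ.+ q ℕ.* c) S                          ≈⟨ rsum-+ c (q ℕ.* c) S ⟩
      rsum c (λ m → S (m ℕ.+ q ℕ.* c)) + rsum (q ℕ.* c) S ≈⟨ +-cong (rsum-cong c (periodic-+* q)) (rsum-periodic q) ⟩
      rsum c S + ℕ→R R q * rsum c S                   ≈⟨ +-congʳ (*-identityˡ _) ⟨
      1# * rsum c S + ℕ→R R q * rsum c S              ≈⟨ distribʳ _ _ _ ⟨
      ℕ→R R (suc q) * rsum c S                        ∎

  boxSum-suc : ∀ n t f → boxSum R (suc n) t f ≈ rsum (head t) (λ m → boxSum R n (tail t) (λ v → f (m ∷ v)))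
  boxSum-suc n t f = unfold
    where
      -- boxSum's where-bound recursion cannot be named here; unification finds it.
      go : ℕ → Carrier
      go = _
      unfold : boxSum R (suc n) t f ≈ rsum (head t) (λ m → boxSum R n (tail t) (λ v → f (m ∷ v)))
      unfold with head t
      ... | k = rsum-unique _ go ≈-refl (λ _ → ≈-refl) k

  boxSum-cong : ∀ n t {f g} → (∀ v → f v ≈ g v) → boxSum R n t f ≈ boxSum R n t g
  boxSum-cong zero    t f≈g = f≈g _
  boxSum-cong (suc n) t {f} {g} f≈g = begin
    boxSum R (suc n) t f                                          ≈⟨ boxSum-suc n t f ⟩
    rsum (head t) (λ m → boxSum R n (tail t) (λ v → f (m ∷ v)))   ≈⟨ rsum-cong (head t) (λ m → boxSum-cong n (tail t) (λ v → f≈g (m ∷ v))) ⟩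
    rsum (head t) (λ m → boxSum R n (tail t) (λ v → g (m ∷ v)))   ≈⟨ boxSum-suc n t g ⟨
    boxSum R (suc n) t g                                          ∎

  Periodic : {n : ℕ} → ℕ → (Vector ℕ n → Carrier) → Set ℓ
  Periodic c f = ∀ j v → f (shiftAt c j v) ≈ f v

  boxSum-periodic : ∀ c n t f → (∀ j → c ∣ t j) → Periodic c f →
                    ℕ→R R (c ℕ.^ n) * boxSum R n t f ≈ ℕ→R R (prodℕ n t) * boxSum R n (λ _ → c) f
  boxSum-periodic c zero    t f c∣t f-periodic = ≈-refl
  boxSum-periodic c (suc n) t f c∣t f-periodic with c∣t zero
  ... | divides q t₀≡q*c = begin
    ℕ→R R (c ℕ.* c ℕ.^ n) * boxSum R (suc n) t f         ≈⟨ *-cong (ℕ→R-homo-* c (c ℕ.^ n)) (boxSum-suc n t f) ⟩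
    (C * Cⁿ) * rsum (head t) (λ m → boxSum R n t′ (slice m)) ≈⟨ *-assoc _ _ _ ⟩
    C * (Cⁿ * rsum (head t) (λ m → boxSum R n t′ (slice m))) ≈⟨ *-congˡ (*-distribˡ-rsum Cⁿ (head t) _) ⟩
    C * rsum (head t) (λ m → Cⁿ * boxSum R n t′ (slice m))   ≈⟨ *-congˡ (rsum-cong (head t) slice-sum) ⟩
    C * rsum (head t) (λ m → P′ * S m)                       ≈⟨ *-congˡ (*-distribˡ-rsum P′ (head t) S) ⟨
    C * (P′ * rsum (head t) S)                               ≡⟨ cong (λ k → C * (P′ * rsum k S)) t₀≡q*c ⟩
    C * (P′ * rsum (q ℕ.* c) S)                              ≈⟨ *-congˡ (*-congˡ (rsum-periodic S-periodic q)) ⟩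
    C * (P′ * (Q * rsum c S))                                ≈⟨ *-congˡ (x∙yz≈yx∙z P′ Q _) ⟩
    C * ((Q * P′) * rsum c S)                                ≈⟨ *-assoc _ _ _ ⟨
    (C * (Q * P′)) * rsum c S                                ≈⟨ *-congʳ (x∙yz≈yx∙z C Q P′) ⟩
    ((Q * C) * P′) * rsum c S                                ≈⟨ *-congʳ prod-t ⟨
    ℕ→R R (prodℕ (suc n) t) * rsum c S                      ≈⟨ *-congˡ (boxSum-suc n (λ _ → c) f) ⟨
    ℕ→R R (prodℕ (suc n) t) * boxSum R (suc n) (λ _ → c) f  ∎
    where
      t′ : Vector ℕ n
      t′ = tail t
      C Cⁿ P′ Q : Carrier
      C  = ℕ→R R c
      Cⁿ = ℕ→R R (c ℕ.^ n)
      P′ = ℕ→R R (prodℕ n t′)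
      Q  = ℕ→R R q
      slice : ℕ → Vector ℕ n → Carrier
      slice m v = f (m ∷ v)
      S : ℕ → Carrier
      S m = boxSum R n (λ _ → c) (slice m)
      slice-sum : ∀ m → Cⁿ * boxSum R n t′ (slice m) ≈ P′ * S m
      slice-sum m = boxSum-periodic c n t′ (slice m) (λ j → c∣t (suc j)) (λ j v → f-periodic (suc j) (m ∷ v))
      S-periodic : ∀ m → S (m ℕ.+ c) ≈ S m
      S-periodic m = boxSum-cong n (λ _ → c) (λ v → f-periodic zero (m ∷ v))
      prod-t : ℕ→R R (prodℕ (suc n) t) ≈ (Q * C) * P′
      prod-t = begin
        ℕ→R R (head t ℕ.* prodℕ n t′)   ≈⟨ ℕ→R-homo-* (head t) (prodℕ n t′) ⟩
        ℕ→R R (head t) * P′              ≡⟨ cong (λ k → ℕ→R R k * P′) t₀≡q*c ⟩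
        ℕ→R R (q ℕ.* c) * P′             ≈⟨ *-congʳ (ℕ→R-homo-* q c) ⟩
        (Q * C) * P′                     ∎

  expChar-+ℤ : ∀ {e p q} → IsExpChar R e → ∃[ k ] q ≡ p ℚ.+ ℤ→ℚ k → e q ≈ e p
  expChar-+ℤ {e} {p} (e-homo , e-ℤ) (k , refl) = begin
    e (p ℚ.+ ℤ→ℚ k)     ≈⟨ e-homo p (ℤ→ℚ k) ⟩
    e p * e (ℤ→ℚ k)     ≈⟨ *-congˡ (e-ℤ k) ⟩
    e p * 1#            ≈⟨ *-identityʳ (e p) ⟩
    e p                 ∎

ℚ-ring : AlmostCommutativeRing 0ℓ 0ℓ
ℚ-ring = fromCommutativeRing ℚP.+-*-commutativeRing (λ _ → nothing)

toℚᵘ-/ : ∀ i d → toℚᵘ (i / suc d) ≃ᵘ mkℚᵘ i d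
toℚᵘ-/ i d = ℚP.toℚᵘ-fromℚᵘ (mkℚᵘ i d)

ℤ→ℚ-homo-+ : ∀ i j → ℤ→ℚ (i ℤ.+ j) ≡ ℤ→ℚ i ℚ.+ ℤ→ℚ j
ℤ→ℚ-homo-+ i j = ℚP.toℚᵘ-injective (begin
  toℚᵘ (ℤ→ℚ (i ℤ.+ j))              ≈⟨ toℚᵘ-/ (i ℤ.+ j) 0 ⟩
  mkℚᵘ (i ℤ.+ j) 0                   ≈⟨ *≡* (+-homo i j) ⟩
  mkℚᵘ i 0 ℚᵘ.+ mkℚᵘ j 0             ≈⟨ ℚᵘP.+-cong (toℚᵘ-/ i 0) (toℚᵘ-/ j 0) ⟨
  toℚᵘ (ℤ→ℚ i) ℚᵘ.+ toℚᵘ (ℤ→ℚ j)    ≈⟨ ℚP.toℚᵘ-homo-+ (ℤ→ℚ i) (ℤ→ℚ j) ⟨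
  toℚᵘ (ℤ→ℚ i ℚ.+ ℤ→ℚ j)            ∎)
  where
    open ℚᵘP.≃-Reasoning
    +-homo : ∀ i j → (i ℤ.+ j) ℤ.* + 1 ≡ (i ℤ.* + 1 ℤ.+ j ℤ.* + 1) ℤ.* + 1
    +-homo = solve-∀ ℤ-ring

ℤ→ℚ-homo-* : ∀ i j → ℤ→ℚ (i ℤ.* j) ≡ ℤ→ℚ i ℚ.* ℤ→ℚ j
ℤ→ℚ-homo-* i j = ℚP.toℚᵘ-injective (begin
  toℚᵘ (ℤ→ℚ (i ℤ.* j))              ≈⟨ toℚᵘ-/ (i ℤ.* j) 0 ⟩
  mkℚᵘ (i ℤ.* j) 0                   ≈⟨ ℚᵘP.*-cong (toℚᵘ-/ i 0) (toℚᵘ-/ j 0) ⟨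
  toℚᵘ (ℤ→ℚ i) ℚᵘ.* toℚᵘ (ℤ→ℚ j)    ≈⟨ ℚP.toℚᵘ-homo-* (ℤ→ℚ i) (ℤ→ℚ j) ⟨
  toℚᵘ (ℤ→ℚ i ℚ.* ℤ→ℚ j)            ∎)
  where open ℚᵘP.≃-Reasoning

i/n*n≡i : ∀ i d → (i / suc d) ℚ.* ℕ→ℚ (suc d) ≡ ℤ→ℚ i
i/n*n≡i i d = ℚP.toℚᵘ-injective (begin
  toℚᵘ ((i / suc d) ℚ.* ℕ→ℚ (suc d))            ≈⟨ ℚP.toℚᵘ-homo-* (i / suc d) (ℕ→ℚ (suc d)) ⟩
  toℚᵘ (i / suc d) ℚᵘ.* toℚᵘ (ℕ→ℚ (suc d))      ≈⟨ ℚᵘP.*-cong (toℚᵘ-/ i d) (toℚᵘ-/ (+ suc d) 0) ⟩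
  mkℚᵘ i d ℚᵘ.* mkℚᵘ (+ suc d) 0                 ≈⟨ *≡* cross ⟩
  mkℚᵘ i 0                                       ≈⟨ toℚᵘ-/ i 0 ⟨
  toℚᵘ (ℤ→ℚ i)                                  ∎)
  where
    open ℚᵘP.≃-Reasoning
    cross : (i ℤ.* + suc d) ℤ.* + 1 ≡ i ℤ.* + (suc d ℕ.* 1)
    cross = trans (ℤP.*-identityʳ _) (cong (λ m → i ℤ.* + m) (sym (ℕP.*-identityʳ (suc d))))

IsInt[i/n*t]⇒n∣t : ∀ {i d t} → Coprime i (+ suc d) → IsInt ((i / suc d) ℚ.* ℕ→ℚ t) → suc d ∣ t
IsInt[i/n*t]⇒n∣t {i} {d} {t} i⊥n (k , i/n*t≡k) =
  coprime-divisor (+ suc d) i (+ t) (ℤC.sym {i} {+ suc d} i⊥n)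
    (divides ℤ.∣ k ∣ (trans (cong ℤ.∣_∣ i*t≡k*n) (ℤP.abs-* k (+ suc d))))
  where
    open ℚᵘP.≃-Reasoning
    i/n*t≃k : mkℚᵘ i d ℚᵘ.* mkℚᵘ (+ t) 0 ≃ᵘ mkℚᵘ k 0
    i/n*t≃k = begin
      mkℚᵘ i d ℚᵘ.* mkℚᵘ (+ t) 0            ≈⟨ ℚᵘP.*-cong (toℚᵘ-/ i d) (toℚᵘ-/ (+ t) 0) ⟨
      toℚᵘ (i / suc d) ℚᵘ.* toℚᵘ (ℕ→ℚ t)    ≈⟨ ℚP.toℚᵘ-homo-* (i / suc d) (ℕ→ℚ t) ⟨
      toℚᵘ ((i / suc d) ℚ.* ℕ→ℚ t)          ≈⟨ ℚP.toℚᵘ-cong i/n*t≡k ⟩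
      toℚᵘ (ℤ→ℚ k)                          ≈⟨ toℚᵘ-/ k 0 ⟩
      mkℚᵘ k 0                              ∎
    i*t≡k*n : i ℤ.* + t ≡ k ℤ.* + suc d
    i*t≡k*n = trans (sym (ℤP.*-identityʳ _))
                (trans (ℚᵘP.drop-*≡* i/n*t≃k) (cong (λ m → k ℤ.* + m) (ℕP.*-identityʳ (suc d))))

IsInt-+ : ∀ {p q} → IsInt p → IsInt q → IsInt (p ℚ.+ q)
IsInt-+ (k , refl) (l , refl) = k ℤ.+ l , sym (ℤ→ℚ-homo-+ k l)

IsInt-* : ∀ {p q} → IsInt p → IsInt q → IsInt (p ℚ.* q)
IsInt-* (k , refl) (l , refl) = k ℤ.* l , sym (ℤ→ℚ-homo-* k l)

IsInt-sumℚ : ∀ n f → (∀ i → IsInt (f i)) → IsInt (sumℚ n f)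
IsInt-sumℚ zero    f f-int = + 0 , refl
IsInt-sumℚ (suc n) f f-int = IsInt-+ (f-int zero) (IsInt-sumℚ n (tail f) (λ i → f-int (suc i)))

IsInt-½*even : ∀ {g k} → g ≡ + 2 ℤ.* k → IsInt (ℚ.½ ℚ.* ℤ→ℚ g)
IsInt-½*even {k = k} refl = k , (begin
  ℚ.½ ℚ.* ℤ→ℚ (+ 2 ℤ.* k)              ≡⟨ cong (ℚ.½ ℚ.*_) (ℤ→ℚ-homo-* (+ 2) k) ⟩
  ℚ.½ ℚ.* (ℤ→ℚ (+ 2) ℚ.* ℤ→ℚ k)        ≡⟨ ℚP.*-assoc ℚ.½ (ℤ→ℚ (+ 2)) (ℤ→ℚ k) ⟨
  ℚ.1ℚ ℚ.* ℤ→ℚ k                        ≡⟨ ℚP.*-identityˡ (ℤ→ℚ k) ⟩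
  ℤ→ℚ k                                 ∎)
  where open ≡-Reasoning

sumℚ≡sum : ∀ n f → sumℚ n f ≡ sum f
sumℚ≡sum zero    f = refl
sumℚ≡sum (suc n) f = cong (f zero ℚ.+_) (sumℚ≡sum n (tail f))

sumℚ-cong : ∀ n {f g} → (∀ i → f i ≡ g i) → sumℚ n f ≡ sumℚ n g
sumℚ-cong n {f} {g} f≗g = begin
  sumℚ n f   ≡⟨ sumℚ≡sum n f ⟩
  sum f      ≡⟨ sum-cong-≗ f≗g ⟩
  sum g      ≡⟨ sumℚ≡sum n g ⟨
  sumℚ n g   ∎
  where open ≡-Reasoning

sumℚ-+ : ∀ n f g → sumℚ n (λ i → f i ℚ.+ g i) ≡ sumℚ n f ℚ.+ sumℚ n g
sumℚ-+ n f g = begin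
  sumℚ n (λ i → f i ℚ.+ g i)   ≡⟨ sumℚ≡sum n _ ⟩
  sum (λ i → f i ℚ.+ g i)      ≡⟨ ∑-distrib-+ f g ⟩
  sum f ℚ.+ sum g              ≡⟨ cong₂ ℚ._+_ (sumℚ≡sum n f) (sumℚ≡sum n g) ⟨
  sumℚ n f ℚ.+ sumℚ n g        ∎
  where open ≡-Reasoning

sumℚ-* : ∀ n k f → sumℚ n (λ i → k ℚ.* f i) ≡ k ℚ.* sumℚ n f
sumℚ-* n k f = begin
  sumℚ n (λ i → k ℚ.* f i)   ≡⟨ sumℚ≡sum n _ ⟩
  sum (λ i → k ℚ.* f i)      ≡⟨ *-distribˡ-sum k f ⟨
  k ℚ.* sum f                ≡⟨ cong (k ℚ.*_) (sumℚ≡sum n f) ⟨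
  k ℚ.* sumℚ n f             ∎
  where open ≡-Reasoning

δ : {n : ℕ} → Fin n → Fin n → ℚ
δ zero    zero    = ℚ.1ℚ
δ zero    (suc i) = ℚ.0ℚ
δ (suc j) zero    = ℚ.0ℚ
δ (suc j) (suc i) = δ j i

module _ {n : ℕ} where
  open ≡-Reasoning

  dot-comm : (u y : Vector ℚ n) → dot u y ≡ dot y u
  dot-comm u y = sumℚ-cong n (λ i → ℚP.*-comm (u i) (y i))

  dot-cong : ∀ {u u′ y y′ : Vector ℚ n} → (∀ i → u i ≡ u′ i) → (∀ i → y i ≡ y′ i) → dot u y ≡ dot u′ y′
  dot-cong u≗u′ y≗y′ = sumℚ-cong n (λ i → cong₂ ℚ._*_ (u≗u′ i) (y≗y′ i))

  dot-+ʳ : (u y z : Vector ℚ n) → dot u (λ i → y i ℚ.+ z i) ≡ dot u y ℚ.+ dot u z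
  dot-+ʳ u y z = trans (sumℚ-cong n (λ i → ℚP.*-distribˡ-+ (u i) (y i) (z i))) (sumℚ-+ n _ _)

  dot-*ʳ : (u : Vector ℚ n) (k : ℚ) (z : Vector ℚ n) → dot u (λ i → k ℚ.* z i) ≡ k ℚ.* dot u z
  dot-*ʳ u k z = trans (sumℚ-cong n (λ i → x∙yz≈y∙xz (u i) k (z i))) (sumℚ-* n k _)

  dot-zeroʳ : (u : Vector ℚ n) → dot u (λ _ → ℚ.0ℚ) ≡ ℚ.0ℚ
  dot-zeroʳ u = begin
    dot u (λ _ → ℚ.0ℚ)      ≡⟨ sumℚ-cong n (λ i → ℚP.*-zeroʳ (u i)) ⟩
    sumℚ n (λ _ → ℚ.0ℚ)     ≡⟨ sumℚ≡sum n _ ⟩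
    sum {n} (λ _ → ℚ.0ℚ)    ≡⟨ sum-replicate-zero n ⟩
    ℚ.0ℚ                    ∎

dot-δʳ : ∀ {n} (y : Vector ℚ n) j → dot y (δ j) ≡ y j
dot-δʳ {suc n} y zero = begin
  y zero ℚ.* ℚ.1ℚ ℚ.+ dot (tail y) (λ _ → ℚ.0ℚ)   ≡⟨ cong₂ ℚ._+_ (ℚP.*-identityʳ (y zero)) (dot-zeroʳ (tail y)) ⟩
  y zero ℚ.+ ℚ.0ℚ                                 ≡⟨ ℚP.+-identityʳ (y zero) ⟩
  y zero                                          ∎
  where open ≡-Reasoning
dot-δʳ {suc n} y (suc j) = begin
  y zero ℚ.* ℚ.0ℚ ℚ.+ dot (tail y) (δ j)   ≡⟨ cong₂ ℚ._+_ (ℚP.*-zeroʳ (y zero)) (dot-δʳ (tail y) j) ⟩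
  ℚ.0ℚ ℚ.+ y (suc j)                       ≡⟨ ℚP.+-identityˡ (y (suc j)) ⟩
  y (suc j)                                ∎
  where open ≡-Reasoning

module _ {n : ℕ} where
  open ≡-Reasoning

  dot-shiftʳ : (u y : Vector ℚ n) (k : ℚ) (j : Fin n) → dot u (λ i → y i ℚ.+ k ℚ.* δ j i) ≡ dot u y ℚ.+ k ℚ.* u j
  dot-shiftʳ u y k j = begin
    dot u (λ i → y i ℚ.+ k ℚ.* δ j i)      ≡⟨ dot-+ʳ u y _ ⟩
    dot u y ℚ.+ dot u (λ i → k ℚ.* δ j i)  ≡⟨ cong (dot u y ℚ.+_) (dot-*ʳ u k (δ j)) ⟩
    dot u y ℚ.+ k ℚ.* dot u (δ j)          ≡⟨ cong (λ z → dot u y ℚ.+ k ℚ.* z) (dot-δʳ u j) ⟩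
    dot u y ℚ.+ k ℚ.* u j                  ∎

  dot-shiftˡ : (u y : Vector ℚ n) (k : ℚ) (j : Fin n) → dot (λ i → u i ℚ.+ k ℚ.* δ j i) y ≡ dot u y ℚ.+ k ℚ.* y j
  dot-shiftˡ u y k j = begin
    dot (λ i → u i ℚ.+ k ℚ.* δ j i) y   ≡⟨ dot-comm _ y ⟩
    dot y (λ i → u i ℚ.+ k ℚ.* δ j i)   ≡⟨ dot-shiftʳ y u k j ⟩
    dot y u ℚ.+ k ℚ.* y j               ≡⟨ cong (ℚ._+ k ℚ.* y j) (dot-comm y u) ⟩
    dot u y ℚ.+ k ℚ.* y j               ∎

  module _ (G : Fin n → Fin n → ℤ) (G-sym : ∀ i j → G i j ≡ G j i) where
    dot-column : (u : Vector ℚ n) (j : Fin n) → dot u (λ i → ℤ→ℚ (G i j)) ≡ matVec G u j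
    dot-column u j = trans (dot-comm u _) (sumℚ-cong n (λ i → cong (λ g → ℤ→ℚ g ℚ.* u i) (G-sym i j)))

    quadratic-shift : (u : Vector ℚ n) (k : ℚ) (j : Fin n) →
      let u′ = λ i → u i ℚ.+ k ℚ.* δ j i in
      dot u′ (matVec G u′) ≡
        (dot u (matVec G u) ℚ.+ k ℚ.* matVec G u j) ℚ.+ k ℚ.* (matVec G u j ℚ.+ k ℚ.* ℤ→ℚ (G j j))
    quadratic-shift u k j = begin
      dot u′ (matVec G u′)
        ≡⟨ dot-cong {u = u′} (λ _ → refl) (λ i → dot-shiftʳ (λ l → ℤ→ℚ (G i l)) u k j) ⟩
      dot u′ (λ i → matVec G u i ℚ.+ k ℚ.* column i)
        ≡⟨ dot-+ʳ u′ (matVec G u) _ ⟩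
      dot u′ (matVec G u) ℚ.+ dot u′ (λ i → k ℚ.* column i)
        ≡⟨ cong (dot u′ (matVec G u) ℚ.+_) (dot-*ʳ u′ k column) ⟩
      dot u′ (matVec G u) ℚ.+ k ℚ.* dot u′ column
        ≡⟨ cong₂ (λ p q → p ℚ.+ k ℚ.* q) (dot-shiftˡ u (matVec G u) k j) (dot-shiftˡ u column k j) ⟩
      (dot u (matVec G u) ℚ.+ k ℚ.* matVec G u j) ℚ.+ k ℚ.* (dot u column ℚ.+ k ℚ.* column j)
        ≡⟨ cong (λ p → (dot u (matVec G u) ℚ.+ k ℚ.* matVec G u j) ℚ.+ k ℚ.* (p ℚ.+ k ℚ.* column j)) (dot-column u j) ⟩
      (dot u (matVec G u) ℚ.+ k ℚ.* matVec G u j) ℚ.+ k ℚ.* (matVec G u j ℚ.+ k ℚ.* column j)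
        ∎
      where
        u′ column : Vector ℚ n
        u′ i = u i ℚ.+ k ℚ.* δ j i
        column i = ℤ→ℚ (G i j)

q≡q+k*0 : ∀ q k → q ≡ q ℚ.+ k ℚ.* ℚ.0ℚ
q≡q+k*0 q k = sym (trans (cong (q ℚ.+_) (ℚP.*-zeroʳ k)) (ℚP.+-identityʳ q))

ℕ→ℚ-shiftAt : ∀ {n} c (j : Fin n) v i → ℕ→ℚ (shiftAt c j v i) ≡ ℕ→ℚ (v i) ℚ.+ ℕ→ℚ c ℚ.* δ j i
ℕ→ℚ-shiftAt {suc n} c zero    v zero    =
  trans (ℤ→ℚ-homo-+ (+ v zero) (+ c)) (cong (ℕ→ℚ (v zero) ℚ.+_) (sym (ℚP.*-identityʳ (ℕ→ℚ c))))
ℕ→ℚ-shiftAt {suc n} c zero    v (suc i) = q≡q+k*0 (ℕ→ℚ (v (suc i))) (ℕ→ℚ c)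
ℕ→ℚ-shiftAt {suc n} c (suc j) v zero    = q≡q+k*0 (ℕ→ℚ (v zero)) (ℕ→ℚ c)
ℕ→ℚ-shiftAt {suc n} c (suc j) v (suc i) = ℕ→ℚ-shiftAt c j (tail v) i

_⊕_ : {n : ℕ} → Vector ℕ n → Vector ℚ n → Vector ℚ n
(v ⊕ w) i = ℕ→ℚ (v i) ℚ.+ w i

module _ {n : ℕ} (G : Fin n → Fin n → ℤ) (w x : Vector ℚ n) where
  open ≡-Reasoning

  phaseJump : ℚ → ℕ → Fin n → Vector ℕ n → ℚ
  phaseJump ρ c j v = ρ ℚ.* matVec G (v ⊕ w) j ℚ.+ (ρ ℚ.* (ℕ→ℚ c ℚ.* (ℚ.½ ℚ.* ℤ→ℚ (G j j))) ℚ.+ ρ ℚ.* x j)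

  phase-shiftAt : (∀ i j → G i j ≡ G j i) → ∀ r c j v →
    phase G r (shiftAt c j v) w x ≡ phase G r v w x ℚ.+ phaseJump (r ℚ.* ℕ→ℚ c) c j v
  phase-shiftAt G-sym r c j v = begin
    r ℚ.* form (shiftAt c j v ⊕ w)
      ≡⟨ cong (r ℚ.*_) form-cong ⟩
    r ℚ.* form u′
      ≡⟨ cong₂ (λ q l → r ℚ.* (ℚ.½ ℚ.* q ℚ.+ l)) (quadratic-shift G G-sym u C j) (dot-shiftˡ u x C j) ⟩
    r ℚ.* (ℚ.½ ℚ.* ((dot u (matVec G u) ℚ.+ C ℚ.* M) ℚ.+ C ℚ.* (M ℚ.+ C ℚ.* g)) ℚ.+ (dot u x ℚ.+ C ℚ.* x j))
      ≡⟨ expand r (dot u (matVec G u)) C M g (dot u x) (x j) ⟩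
    r ℚ.* form u ℚ.+ phaseJump (r ℚ.* C) c j v
      ∎
    where
      -- phase G r v w x unfolds to r ℚ.* form (v ⊕ w).
      form : Vector ℚ n → ℚ
      form y = ℚ.½ ℚ.* dot y (matVec G y) ℚ.+ dot y x
      C M g : ℚ
      C = ℕ→ℚ c
      M = matVec G (v ⊕ w) j
      g = ℤ→ℚ (G j j)
      u u′ : Vector ℚ n
      u = v ⊕ w
      u′ i = u i ℚ.+ C ℚ.* δ j i
      shift≗u′ : ∀ i → (shiftAt c j v ⊕ w) i ≡ u′ i
      shift≗u′ i = trans (cong (ℚ._+ w i) (ℕ→ℚ-shiftAt c j v i)) (swap (ℕ→ℚ (v i)) (C ℚ.* δ j i) (w i))
        where
          swap : ∀ p q s → (p ℚ.+ q) ℚ.+ s ≡ (p ℚ.+ s) ℚ.+ q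
          swap = solve-∀ ℚ-ring
      form-cong : form (shiftAt c j v ⊕ w) ≡ form u′
      form-cong = cong₂ (λ q l → ℚ.½ ℚ.* q ℚ.+ l)
                    (dot-cong shift≗u′ (λ i → dot-cong {u = λ l → ℤ→ℚ (G i l)} (λ _ → refl) shift≗u′)) (dot-cong shift≗u′ (λ _ → refl))
      expand : ∀ r D C M g E y →
        r ℚ.* (ℚ.½ ℚ.* ((D ℚ.+ C ℚ.* M) ℚ.+ C ℚ.* (M ℚ.+ C ℚ.* g)) ℚ.+ (E ℚ.+ C ℚ.* y)) ≡
        r ℚ.* (ℚ.½ ℚ.* D ℚ.+ E) ℚ.+ ((r ℚ.* C) ℚ.* M ℚ.+ ((r ℚ.* C) ℚ.* (C ℚ.* (ℚ.½ ℚ.* g)) ℚ.+ (r ℚ.* C) ℚ.* y))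
      expand = solve-∀ ℚ-ring

  phase-shiftAt-integral : EvenIntegralSymmetric G → ∀ r a {c} → r ℚ.* ℕ→ℚ c ≡ ℤ→ℚ a →
    (∀ i → IsInt (matVec G w i)) → (∀ i → IsInt (ℤ→ℚ a ℚ.* x i)) →
    ∀ j v → ∃[ K ] phase G r (shiftAt c j v) w x ≡ phase G r v w x ℚ.+ ℤ→ℚ K
  phase-shiftAt-integral (G-sym , G-even) r a {c} rc≡a Gw-int ax-int j v =
    proj₁ jump-int , (begin
      phase G r (shiftAt c j v) w x                    ≡⟨ phase-shiftAt G-sym r c j v ⟩
      phase G r v w x ℚ.+ phaseJump (r ℚ.* ℕ→ℚ c) c j v ≡⟨ cong (λ ρ → phase G r v w x ℚ.+ phaseJump ρ c j v) rc≡a ⟩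
      phase G r v w x ℚ.+ phaseJump (ℤ→ℚ a) c j v      ≡⟨ cong (phase G r v w x ℚ.+_) (proj₂ jump-int) ⟩
      phase G r v w x ℚ.+ ℤ→ℚ (proj₁ jump-int)         ∎)
    where
      M : ℚ
      M = matVec G (v ⊕ w) j
      M-int : IsInt M
      M-int = subst IsInt (sym (dot-+ʳ (λ l → ℤ→ℚ (G j l)) (λ i → ℕ→ℚ (v i)) w))
                (IsInt-+ (IsInt-sumℚ n _ (λ i → IsInt-* (G j i , refl) (+ v i , refl))) (Gw-int j))
      jump-int : IsInt (phaseJump (ℤ→ℚ a) c j v)
      jump-int = IsInt-+ (IsInt-* (a , refl) M-int)
                (IsInt-+ (IsInt-* (a , refl) (IsInt-* (+ c , refl) (IsInt-½*even (proj₂ (G-even j))))) (ax-int j))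

proposition3p5 : {cℓ ℓ : Level} (R : CommutativeRing cℓ ℓ) (e : ℚ → CommutativeRing.Carrier R) → IsExpChar R e →
    (n : ℕ) (G : Fin n → Fin n → ℤ) → EvenIntegralSymmetric G →
    (a : ℤ) (c : ℕ) .{{_ : NonZero c}} → Coprime a (+ c) →
    (t : Fin n → ℕ) → ((j : Fin n) → 1 ℕ.≤ t j) →
    (w x : Fin n → ℚ) →
    ((j : Fin n) → IsInt ((a / c) ℚ.* ℕ→ℚ (t j))) →
    ((i : Fin n) → IsInt (matVec G w i)) →
    ((j : Fin n) → IsInt (ℤ→ℚ a ℚ.* x j)) →
    CommutativeRing._≈_ R
      (CommutativeRing._*_ R (ℕ→R R (c ℕ.^ n)) (𝔊 R e G (a / c) t w x))
      (CommutativeRing._*_ R (ℕ→R R (prodℕ n t)) (𝔊 R e G (a / c) (λ _ → c) w x))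
proposition3p5 R e e-char n G G-even a (suc c) a⊥c t _ w x at/c-int Gw-int ax-int =
  boxSum-periodic (suc c) n t summand (λ j → IsInt[i/n*t]⇒n∣t {a} a⊥c (at/c-int j)) summand-periodic
  where
    open BoxSum R
    summand : Vector ℕ n → CommutativeRing.Carrier R
    summand v = e (phase G (a / suc c) v w x)
    summand-periodic : Periodic (suc c) summand
    summand-periodic j v =
      expChar-+ℤ e-char (phase-shiftAt-integral G w x G-even (a / suc c) a (i/n*n≡i a c) Gw-int ax-int j v)
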